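{- Let ${\boldsymbol{k}}=(k_1,\dots,k_r)\in\mathbb{Z}^r$ with $r\ge2$, and suppose $k_m=-k$ for some $m\in\{1,\dots,r\}$ and some integer $k\ge0$. Then in $\widehat{\mathcal{A}}$: (i) If $m=1$, \[\zeta_{\widehat{\mathcal{A}}}({\boldsymbol{k}})=\frac{1}{k+1}\sum_{j=0}^{k+1}\binom{k+1}{j}B_j\Bigl((-1)^j\zeta_{\widehat{\mathcal{A}}}(k_2-k-1+j,k_3,\dots,k_r)-\delta_{j,k+1}\,\zeta_{\widehat{\mathcal{A}}}(k_2,\dots,k_r)\Bigr).\] (ii) If $1<m<r$, \[\zeta_{\widehat{\mathcal{A}}}({\boldsymbol{k}})=\frac{1}{k+1}\sum_{j=0}^{k+1}\binom{k+1}{j}B_j\Bigl((-1)^j\zeta_{\widehat{\mathcal{A}}}(k_1,\dots,k_{m-1},k_{m+1}-k-1+j,k_{m+2},\dots,k_r)-\zeta_{\widehat{\mathcal{A}}}(k_1,\dots,k_{m-2},k_{m-1}-k-1+j,k_{m+1},\dots,k_r)\Bigr).\] (iii) If $m=r$, \[\zeta_{\widehat{\mathcal{A}}}({\boldsymbol{k}})=\frac{1}{k+1}\sum_{j=0}^{k+1}\binom{k+1}{j}B_j\Bigl((-1)^j\zeta_{\widehat{\mathcal{A}}}(k_1,\dots,k_{r-1})\,{\boldsymbol{p}}^{k+1-j}-\zeta_{\widehat{\mathcal{A}}}(k_1,\dots,k_{r-2},k_{r-1}-k-1+j)\Bigr).\] (All indices on the right have depth $r-1$: the entry $k_m$ is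 deleted and one neighbouring entry is modified as shown.)
   Context: $B_n$ are the Seki–Bernoulli numbers, $ze^z/(e^z-1)=\sum_{n\ge0}B_nz^n/n!$ (so $B_1=1/2$); $\delta$ is the Kronecker delta; ${\boldsymbol{p}}^0=1$. $\widehat{\mathcal{A}}:=\varprojlim_n\bigl[(\prod_{p}\mathbb{Z}/p^n\mathbb{Z})/(\bigoplus_p\mathbb{Z}/p^n\mathbb{Z})\bigr]$ ($p$ over primes), a $\mathbb{Q}$-algebra with $\mathbb{Q}$ embedded diagonally. For an index ${\boldsymbol{l}}=(l_1,\dots,l_s)\in\mathbb{Z}^s$ and a prime $p$, $\zeta_p({\boldsymbol{l}}):=\sum_{0<n_1<\cdots<n_s<p}n_1^{ -l_1}\cdots n_s^{ -l_s}\in\mathbb{Z}_{(p)}$ (equal to $1$ if $s=0$), and $\zeta_{\widehat{\mathcal{A}}}({\boldsymbol{l}}):=\bigl((\zeta_p({\boldsymbol{l}})\bmod p^n)_p\bigr)_n$. ${\boldsymbol{p}}:=\bigl((p\bmod p^n)_p\bigr)_n\in\widehat{\mathcal{A}}$. -}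

module Defs where

open import Data.Nat as ℕ using (ℕ; zero; suc; _<_; _≤ᵇ_)
open import Data.Nat.Properties using (m^n≢0)
open import Data.Nat.Combinatorics using (_C_)
open import Data.Nat.Divisibility using (_∣_)
open import Data.Nat.Primality using (Prime)
open import Data.Integer as ℤ using (ℤ; +_; -[1+_])
open import Data.Rational as ℚ using (ℚ; _/_; ↥_)
open import Data.List using (List; []; _∷_)
open import Data.Bool using (if_then_else_)
open import Data.Product using (∃)

ℤ→ℚ : ℤ → ℚ
ℤ→ℚ z = z / 1

ℕ→ℚ : ℕ → ℚ
ℕ→ℚ n = (+ n) / 1

_^ℚ_ : ℚ → ℕ → ℚ
q ^ℚ zero = ℚ.1ℚ
q ^ℚ suc n = q ℚ.* (q ^ℚ n)

Σ< : ℕ → (ℕ → ℚ) → ℚ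
Σ< zero f = ℚ.0ℚ
Σ< (suc n) f = Σ< n f ℚ.+ f n

-- (suc i) ^ (- l) for l : ℤ
invPow : ℕ → ℤ → ℚ
invPow i (+ k) = _/_ (+ 1) (suc i ℕ.^ k) {{m^n≢0 (suc i) k}}
invPow i -[1+ k ] = ℕ→ℚ (suc i ℕ.^ suc k)

-- zetaFrom l L M = Σ_{L < n_1 < ... < n_s < M} n_1^{-l_1} ... n_s^{-l_s}
zetaFrom : List ℤ → ℕ → ℕ → ℚ
zetaFrom [] L M = ℚ.1ℚ
zetaFrom (a ∷ l) L M =
  Σ< (M ℕ.∸ suc L) (λ i → invPow (L ℕ.+ i) a ℚ.* zetaFrom l (suc (L ℕ.+ i)) M)
  -- the summation variable is n = suc (L + i), ranging over L < n < M

ζp : List ℤ → ℕ → ℚ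
ζp l p = zetaFrom l 0 p

-- Seki–Bernoulli numbers (B_1 = +1/2), via the recursion
--   Σ_{j=0}^{n} C(n+1,j) B_j = n+1   (n ≥ 0),
-- equivalent to z e^z/(e^z - 1) = Σ B_n z^n / n!.
-- bernUpTo n j = B_j for j ≤ n.
bernUpTo : ℕ → ℕ → ℚ
bernUpTo zero j = ℚ.1ℚ
bernUpTo (suc n) j =
  if j ≤ᵇ n then bernUpTo n j
  else ((+ 1) / suc (suc n)) ℚ.*
         (ℕ→ℚ (suc (suc n)) ℚ.- Σ< (suc n) (λ i → ℕ→ℚ (suc (suc n) C i) ℚ.* bernUpTo n i))

B : ℕ → ℚ
B n = bernUpTo n n

δ : ℕ → ℕ → ℚ
δ i j = if (i ≤ᵇ j) then (if (j ≤ᵇ i) then ℚ.1ℚ else ℚ.0ℚ) else ℚ.0ℚ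

-- Equality in Â of the images of two prime-indexed families of rationals
-- (each p-component lying in Z_(p) for all large p):
-- for every n, the components agree mod p^n for all but finitely many primes p,
-- i.e. v_p(x_p - y_p) ≥ n, i.e. p^n divides the numerator of x_p - y_p.
_≈Â_ : (ℕ → ℚ) → (ℕ → ℚ) → Set
x ≈Â y = ∀ (n : ℕ) → ∃ λ (N : ℕ) → ∀ (p : ℕ) → Prime p → N < p →
  (p ℕ.^ n) ∣ ℤ.∣ ↥ (x p ℚ.- y p) ∣

infix 4 _≈Â_

ζÂ : List ℤ → ℕ → ℚ
ζÂ l p = ζp l p

𝒑 : ℕ → ℚ
𝒑 p = ℕ→ℚ p

sh : ℤ → ℕ → ℕ → ℤ
sh a k j = a ℤ.- (+ k) ℤ.- (+ 1) ℤ.+ (+ j)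

bernSum : ℕ → (ℕ → ℚ) → ℚ
bernSum k T = ((+ 1) / suc k) ℚ.*
  Σ< (suc (suc k)) (λ j → ℕ→ℚ (suc k C j) ℚ.* B j ℚ.* T j)

-1ℚ : ℚ
-1ℚ = ℚ.- ℚ.1ℚ

module Submission where

-- For each prime p the three identities already hold exactly in ℚ, hence in Â. In ζ_p(k) with
-- k_m = -k, the sum over n_m between its neighbours n_{m-1} < n_m < n_{m+1} is the power sum Σ nᵏ,
-- which Faulhaber's formula writes as 1/(k+1) Σⱼ C(k+1,j) Bⱼ ((-1)ʲ n_{m+1}^{k+1-j} - n_{m-1}^{k+1-j});
-- each power of a neighbour lowers that neighbour's index by k+1-j (for m = r the upper neighbour
-- is p, for m = 1 the lower one is 0). With B₁ = 1/2 this form of Faulhaber's formula rests on the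
-- reflection Σⱼ C(n,j) (-1)ʲ Bⱼ = Bₙ, i.e. B(-z) eᶻ = B(z) for B(z) = z eᶻ/(eᶻ - 1), which is
-- proved by computing with exponential generating functions.

open import Defs
open import Data.Nat as ℕ using (ℕ; zero; suc; z≤n; s≤s; _<ᵇ_; _!)
import Data.Nat.Properties as ℕP
open import Data.Nat.Combinatorics
  using (_C_; nCk≡nC[n∸k]; nC1≡n; nCk+nC[k+1]≡[n+1]C[k+1]; k![n∸k]!∣n!;
         nCk≡n!/k![n-k]!; k>n⇒nCk≡0)
open import Data.Nat.DivMod using (m/n*n≡m)
open import Data.Nat.Divisibility using (_∣_; _∣0)
open import Data.Integer as ℤ using (ℤ; +_; -[1+_]; -_)
import Data.Integer.Properties as ℤP
import Data.Integer.Solver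
open import Data.Rational as ℚ using (ℚ; _+_; _*_; _-_; 0ℚ; 1ℚ; mkℚ)
import Data.Rational.Properties as ℚP
open import Algebra.Properties.Group ℚP.+-0-group using () renaming (∙-cancelˡ to +-cancelˡ-ℚ)
open import Data.Nat.Coprimality using (1-coprimeTo) renaming (sym to coprime-sym)
open import Data.List using (List; []; _∷_; _++_)
open import Data.Product using (_×_; _,_)
open import Data.Sum using (inj₁; inj₂)
open import Data.Bool using (true; false; T)
open import Data.Bool.Properties using (T-≡)
open import Function.Bundles using (Equivalence)
open import Data.Empty using (⊥-elim)
open import Function using (_∘_)
open import Relation.Nullary using (yes; no)
open import Relation.Binary.PropositionalEquality
open import Data.Rational.Solver
open +-*-Solver
import Data.Nat.Solver
module ℕSolver = Data.Nat.Solver.+-*-Solver renaming (_:*_ to _⊛_; _:=_ to _≐_)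
module ℤSolver = Data.Integer.Solver.+-*-Solver
  renaming (_:+_ to _⊕_; _:-_ to _⊝_; _:=_ to _≐_)
open ≡-Reasoning

ℕ→ℚ≡mkℚ : ∀ n → ℕ→ℚ n ≡ mkℚ (+ n) 0 (coprime-sym (1-coprimeTo n))
ℕ→ℚ≡mkℚ n = ℚP.normalize-coprime (coprime-sym (1-coprimeTo n))

ℕ→ℚ-+ : ∀ m n → ℕ→ℚ (m ℕ.+ n) ≡ ℕ→ℚ m + ℕ→ℚ n
ℕ→ℚ-+ m n = begin
  (+ m ℤ.+ + n) ℚ./ 1
    ≡⟨ cong₂ (λ a b → (a ℤ.+ b) ℚ./ 1) (ℤP.*-identityʳ (+ m)) (ℤP.*-identityʳ (+ n)) ⟨
  (+ m ℤ.* + 1 ℤ.+ + n ℤ.* + 1) ℚ./ 1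
    ≡⟨ cong₂ _+_ (ℕ→ℚ≡mkℚ m) (ℕ→ℚ≡mkℚ n) ⟨
  ℕ→ℚ m + ℕ→ℚ n                       ∎

ℕ→ℚ-* : ∀ m n → ℕ→ℚ (m ℕ.* n) ≡ ℕ→ℚ m * ℕ→ℚ n
ℕ→ℚ-* m n = trans (cong (ℚ._/ 1) (ℤP.pos-* m n)) (sym (cong₂ _*_ (ℕ→ℚ≡mkℚ m) (ℕ→ℚ≡mkℚ n)))

ℕ→ℚ-suc : ∀ n → ℕ→ℚ (suc n) ≡ 1ℚ + ℕ→ℚ n
ℕ→ℚ-suc = ℕ→ℚ-+ 1

ℕ→ℚ-^ : ∀ m n → ℕ→ℚ (m ℕ.^ n) ≡ ℕ→ℚ m ^ℚ n
ℕ→ℚ-^ m zero = refl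
ℕ→ℚ-^ m (suc n) = trans (ℕ→ℚ-* m (m ℕ.^ n)) (cong (ℕ→ℚ m *_) (ℕ→ℚ-^ m n))

1/n*n≡1 : ∀ n .{{_ : ℕ.NonZero n}} → ((+ 1) ℚ./ n) * ℕ→ℚ n ≡ 1ℚ
1/n*n≡1 (suc d) = begin
  ((+ 1) ℚ./ suc d) * ℕ→ℚ (suc d)
    ≡⟨ cong₂ _*_ (ℚP.normalize-coprime {1} {d} (1-coprimeTo (suc d))) (ℕ→ℚ≡mkℚ (suc d)) ⟩
  mkℚ (+ 1) d (1-coprimeTo (suc d)) * mkℚ (+ suc d) 0 (coprime-sym (1-coprimeTo (suc d)))
    ≡⟨ ℚP.*-inverseˡ (mkℚ (+ suc d) 0 (coprime-sym (1-coprimeTo (suc d)))) ⟩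
  1ℚ ∎

1/n*[n*a]≡a : ∀ n .{{_ : ℕ.NonZero n}} a → ((+ 1) ℚ./ n) * (ℕ→ℚ n * a) ≡ a
1/n*[n*a]≡a n a = begin
  ((+ 1) ℚ./ n) * (ℕ→ℚ n * a) ≡⟨ ℚP.*-assoc ((+ 1) ℚ./ n) (ℕ→ℚ n) a ⟨
  ((+ 1) ℚ./ n) * ℕ→ℚ n * a   ≡⟨ cong (_* a) (1/n*n≡1 n) ⟩
  1ℚ * a                      ≡⟨ ℚP.*-identityˡ a ⟩
  a                           ∎

*-cancelˡ-ℕ→ℚ : ∀ n .{{_ : ℕ.NonZero n}} {a b} → ℕ→ℚ n * a ≡ ℕ→ℚ n * b → a ≡ b
*-cancelˡ-ℕ→ℚ n {a} {b} eq =
  trans (sym (1/n*[n*a]≡a n a)) (trans (cong (((+ 1) ℚ./ n) *_) eq) (1/n*[n*a]≡a n b))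

^ℚ-+ : ∀ x a b → x ^ℚ (a ℕ.+ b) ≡ x ^ℚ a * x ^ℚ b
^ℚ-+ x zero b = sym (ℚP.*-identityˡ _)
^ℚ-+ x (suc a) b = trans (cong (x *_) (^ℚ-+ x a b)) (sym (ℚP.*-assoc x _ _))

1^ℚn≡1 : ∀ n → 1ℚ ^ℚ n ≡ 1ℚ
1^ℚn≡1 zero = refl
1^ℚn≡1 (suc n) = trans (ℚP.*-identityˡ _) (1^ℚn≡1 n)

Σ<-cong-< : ∀ n {f g : ℕ → ℚ} → (∀ i → i ℕ.< n → f i ≡ g i) → Σ< n f ≡ Σ< n g
Σ<-cong-< zero eq = refl
Σ<-cong-< (suc n) eq = cong₂ _+_ (Σ<-cong-< n (λ i i<n → eq i (ℕP.m<n⇒m<1+n i<n))) (eq n ℕP.≤-refl)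

Σ<-cong : ∀ n {f g : ℕ → ℚ} → f ≗ g → Σ< n f ≡ Σ< n g
Σ<-cong n eq = Σ<-cong-< n (λ i _ → eq i)

Σ<-zero : ∀ n → Σ< n (λ _ → 0ℚ) ≡ 0ℚ
Σ<-zero zero = refl
Σ<-zero (suc n) = trans (ℚP.+-identityʳ _) (Σ<-zero n)

Σ<-+ : ∀ n (f g : ℕ → ℚ) → Σ< n (λ i → f i + g i) ≡ Σ< n f + Σ< n g
Σ<-+ zero f g = refl
Σ<-+ (suc n) f g = trans (cong (_+ (f n + g n)) (Σ<-+ n f g))
  (solve 4 (λ a b c d → (a :+ b) :+ (c :+ d) := (a :+ c) :+ (b :+ d)) refl (Σ< n f) (Σ< n g) (f n) (g n))

Σ<-*ˡ : ∀ n c (f : ℕ → ℚ) → Σ< n (λ i → c * f i) ≡ c * Σ< n f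
Σ<-*ˡ zero c f = sym (ℚP.*-zeroʳ c)
Σ<-*ˡ (suc n) c f = trans (cong (_+ (c * f n)) (Σ<-*ˡ n c f)) (sym (ℚP.*-distribˡ-+ c _ _))

Σ<-*ʳ : ∀ n c (f : ℕ → ℚ) → Σ< n (λ i → f i * c) ≡ Σ< n f * c
Σ<-*ʳ n c f = trans (Σ<-cong n (λ i → ℚP.*-comm (f i) c)) (trans (Σ<-*ˡ n c f) (ℚP.*-comm c _))

Σ<-- : ∀ n (f g : ℕ → ℚ) → Σ< n (λ i → f i - g i) ≡ Σ< n f - Σ< n g
Σ<-- n f g = trans (Σ<-+ n f (λ i → ℚ.- g i)) (cong (_+_ (Σ< n f)) (Σ<-neg n))
  where
  Σ<-neg : ∀ n → Σ< n (λ i → ℚ.- g i) ≡ ℚ.- Σ< n g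
  Σ<-neg zero = refl
  Σ<-neg (suc n) = trans (cong (_+ (ℚ.- g n)) (Σ<-neg n)) (sym (ℚP.neg-distrib-+ (Σ< n g) (g n)))

Σ<-head : ∀ n (f : ℕ → ℚ) → Σ< (suc n) f ≡ f 0 + Σ< n (λ i → f (suc i))
Σ<-head zero f = trans (ℚP.+-identityˡ (f 0)) (sym (ℚP.+-identityʳ (f 0)))
Σ<-head (suc n) f = trans (cong (_+ f (suc n)) (Σ<-head n f)) (ℚP.+-assoc (f 0) _ _)

Σ<-single : ∀ n k (f : ℕ → ℚ) → k ℕ.< n → (∀ i → i ℕ.< n → i ≢ k → f i ≡ 0ℚ) → Σ< n f ≡ f k
Σ<-single (suc n) k f k<1+n others with k ℕ.≟ n
... | yes refl = trans (cong (_+ f k) (trans (Σ<-cong-< n vanish) (Σ<-zero n))) (ℚP.+-identityˡ (f k))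
  where
  vanish : ∀ i → i ℕ.< n → f i ≡ 0ℚ
  vanish i i<n = others i (ℕP.m<n⇒m<1+n i<n) (ℕP.<⇒≢ i<n)
... | no k≢n = trans (cong₂ _+_ (Σ<-single n k f k<n (λ i i<n → others i (ℕP.m<n⇒m<1+n i<n)))
                                (others n ℕP.≤-refl (k≢n ∘ sym))) (ℚP.+-identityʳ (f k))
  where
  k<n = ℕP.≤∧≢⇒< (ℕP.≤-pred k<1+n) k≢n

Σ<-reverse : ∀ n (f : ℕ → ℚ) → Σ< (suc n) f ≡ Σ< (suc n) (λ j → f (n ℕ.∸ j))
Σ<-reverse zero f = refl
Σ<-reverse (suc n) f = begin
  Σ< (suc n) f + f (suc n)                       ≡⟨ cong (_+ f (suc n)) (Σ<-reverse n f) ⟩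
  Σ< (suc n) (λ j → f (n ℕ.∸ j)) + f (suc n)     ≡⟨ ℚP.+-comm _ (f (suc n)) ⟩
  f (suc n) + Σ< (suc n) (λ j → f (n ℕ.∸ j))     ≡⟨ Σ<-head (suc n) (λ j → f (suc n ℕ.∸ j)) ⟨
  Σ< (suc (suc n)) (λ j → f (suc n ℕ.∸ j))       ∎

Σ<-comm : ∀ m n (F : ℕ → ℕ → ℚ) → Σ< m (λ i → Σ< n (F i)) ≡ Σ< n (λ j → Σ< m (λ i → F i j))
Σ<-comm zero n F = sym (Σ<-zero n)
Σ<-comm (suc m) n F = begin
  Σ< m (λ i → Σ< n (F i)) + Σ< n (F m)            ≡⟨ cong (_+ Σ< n (F m)) (Σ<-comm m n F) ⟩
  Σ< n (λ j → Σ< m (λ i → F i j)) + Σ< n (F m)    ≡⟨ Σ<-+ n _ _ ⟨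
  Σ< n (λ j → Σ< m (λ i → F i j) + F m j)          ∎

Σ<-triangle : ∀ n (F : ℕ → ℕ → ℚ) →
  Σ< (suc n) (λ i → Σ< (suc i) (F i)) ≡ Σ< (suc n) (λ j → Σ< (suc (n ℕ.∸ j)) (λ t → F (j ℕ.+ t) j))
Σ<-triangle zero F = refl
Σ<-triangle (suc n) F = begin
  Σ< (suc n) (λ i → Σ< (suc i) (F i)) + Σ< (suc (suc n)) (F (suc n))
    ≡⟨ cong (_+ Σ< (suc (suc n)) (F (suc n))) (Σ<-triangle n F) ⟩
  Rows n + (Σ< (suc n) (F (suc n)) + F (suc n) (suc n))
    ≡⟨ ℚP.+-assoc (Rows n) _ _ ⟨
  (Rows n + Σ< (suc n) (F (suc n))) + F (suc n) (suc n)
    ≡⟨ cong₂ _+_ (trans (sym (Σ<-+ (suc n) _ _)) (Σ<-cong-< (suc n) extendRow)) (sym lastRow) ⟩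
  Rows (suc n) ∎
  where
  Rows : ℕ → ℚ
  Rows n = Σ< (suc n) (λ j → Σ< (suc (n ℕ.∸ j)) (λ t → F (j ℕ.+ t) j))
  lastRow : Σ< (suc (suc n ℕ.∸ suc n)) (λ t → F (suc n ℕ.+ t) (suc n)) ≡ F (suc n) (suc n)
  lastRow rewrite ℕP.n∸n≡0 n | ℕP.+-identityʳ n = ℚP.+-identityˡ _
  extendRow : ∀ j → j ℕ.< suc n →
    Σ< (suc (n ℕ.∸ j)) (λ t → F (j ℕ.+ t) j) + F (suc n) j ≡ Σ< (suc (suc n ℕ.∸ j)) (λ t → F (j ℕ.+ t) j)
  extendRow j (s≤s j≤n) rewrite ℕP.+-∸-assoc 1 j≤n =
    cong (λ m → Σ< (suc (n ℕ.∸ j)) (λ t → F (j ℕ.+ t) j) + F m j)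
         (sym (trans (ℕP.+-suc j (n ℕ.∸ j)) (cong suc (ℕP.m+[n∸m]≡n j≤n))))

Σ<-triangle-strict : ∀ n (F : ℕ → ℕ → ℚ) →
  Σ< n (λ i → Σ< (n ℕ.∸ suc i) (λ j → F i (suc (i ℕ.+ j)))) ≡ Σ< n (λ t → Σ< t (λ i → F i t))
Σ<-triangle-strict zero F = refl
Σ<-triangle-strict (suc n) F = begin
  Σ< n (λ i → Σ< (n ℕ.∸ i) (Row i)) + Σ< (n ℕ.∸ n) (Row n)
    ≡⟨ cong₂ _+_ (Σ<-cong-< n splitRow) (cong (λ m → Σ< m (Row n)) (ℕP.n∸n≡0 n)) ⟩
  Σ< n (λ i → Σ< (n ℕ.∸ suc i) (Row i) + F i n) + 0ℚ
    ≡⟨ ℚP.+-identityʳ _ ⟩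
  Σ< n (λ i → Σ< (n ℕ.∸ suc i) (Row i) + F i n)
    ≡⟨ Σ<-+ n _ _ ⟩
  Σ< n (λ i → Σ< (n ℕ.∸ suc i) (Row i)) + Σ< n (λ i → F i n)
    ≡⟨ cong (_+ Σ< n (λ i → F i n)) (Σ<-triangle-strict n F) ⟩
  Σ< n (λ t → Σ< t (λ i → F i t)) + Σ< n (λ i → F i n) ∎
  where
  Row : ℕ → ℕ → ℚ
  Row i j = F i (suc (i ℕ.+ j))
  splitRow : ∀ i → i ℕ.< n → Σ< (n ℕ.∸ i) (Row i) ≡ Σ< (n ℕ.∸ suc i) (Row i) + F i n
  splitRow i i<n rewrite ℕP.+-∸-assoc 1 i<n =
    cong (λ m → Σ< (n ℕ.∸ suc i) (Row i) + F i m) (ℕP.m+[n∸m]≡n i<n)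

nCk*[k!*[n∸k]!]≡n! : ∀ {n k} → k ℕ.≤ n → (n C k) ℕ.* (k ! ℕ.* (n ℕ.∸ k) !) ≡ n !
nCk*[k!*[n∸k]!]≡n! {n} {k} k≤n =
  trans (cong (ℕ._* (k ! ℕ.* (n ℕ.∸ k) !)) (nCk≡n!/k![n-k]! k≤n))
        (m/n*n≡m {{k ℕP.!* (n ℕ.∸ k) !≢0}} (k![n∸k]!∣n! k≤n))

-- Multiplied by j! t! (n ∸ (j + t))!, both sides become n!.
nC[j+t]*[j+t]Cj≡nCj*[n∸j]Ct : ∀ {n} j t → j ℕ.+ t ℕ.≤ n →
  (n C (j ℕ.+ t)) ℕ.* ((j ℕ.+ t) C j) ≡ (n C j) ℕ.* ((n ℕ.∸ j) C t)
nC[j+t]*[j+t]Cj≡nCj*[n∸j]Ct {n} j t j+t≤n =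
  ℕP.*-cancelʳ-≡ _ _ (j ! ℕ.* t ! ℕ.* (n ℕ.∸ (j ℕ.+ t)) !)
    {{ℕP.m*n≢0 _ _ {{j ℕP.!* t !≢0}} {{(n ℕ.∸ (j ℕ.+ t)) ℕP.!≢0}}}}
    (trans lhs≡n! (sym rhs≡n!))
  where
  open ℕSolver using (_⊛_; _≐_) renaming (solve to solveℕ)
  j≤n = ℕP.≤-trans (ℕP.m≤m+n j t) j+t≤n
  t≤n∸j = ℕP.m+n≤o⇒m≤o∸n t (subst (ℕ._≤ n) (ℕP.+-comm j t) j+t≤n)
  lhs≡n! : (n C (j ℕ.+ t)) ℕ.* ((j ℕ.+ t) C j) ℕ.* (j ! ℕ.* t ! ℕ.* (n ℕ.∸ (j ℕ.+ t)) !) ≡ n !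
  lhs≡n! = begin
    (n C (j ℕ.+ t)) ℕ.* ((j ℕ.+ t) C j) ℕ.* (j ! ℕ.* t ! ℕ.* (n ℕ.∸ (j ℕ.+ t)) !)
      ≡⟨ solveℕ 5 (λ x y a b c → x ⊛ y ⊛ (a ⊛ b ⊛ c) ≐ x ⊛ ((y ⊛ (a ⊛ b)) ⊛ c)) refl
           (n C (j ℕ.+ t)) ((j ℕ.+ t) C j) (j !) (t !) ((n ℕ.∸ (j ℕ.+ t)) !) ⟩
    (n C (j ℕ.+ t)) ℕ.* (((j ℕ.+ t) C j) ℕ.* (j ! ℕ.* t !) ℕ.* (n ℕ.∸ (j ℕ.+ t)) !)
      ≡⟨ cong (λ m → (n C (j ℕ.+ t)) ℕ.* (((j ℕ.+ t) C j) ℕ.* (j ! ℕ.* m !) ℕ.* (n ℕ.∸ (j ℕ.+ t)) !))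
              (sym (ℕP.m+n∸m≡n j t)) ⟩
    (n C (j ℕ.+ t)) ℕ.* (((j ℕ.+ t) C j) ℕ.* (j ! ℕ.* ((j ℕ.+ t) ℕ.∸ j) !) ℕ.* (n ℕ.∸ (j ℕ.+ t)) !)
      ≡⟨ cong (λ m → (n C (j ℕ.+ t)) ℕ.* (m ℕ.* (n ℕ.∸ (j ℕ.+ t)) !)) (nCk*[k!*[n∸k]!]≡n! (ℕP.m≤m+n j t)) ⟩
    (n C (j ℕ.+ t)) ℕ.* ((j ℕ.+ t) ! ℕ.* (n ℕ.∸ (j ℕ.+ t)) !)
      ≡⟨ nCk*[k!*[n∸k]!]≡n! j+t≤n ⟩
    n ! ∎
  rhs≡n! : (n C j) ℕ.* ((n ℕ.∸ j) C t) ℕ.* (j ! ℕ.* t ! ℕ.* (n ℕ.∸ (j ℕ.+ t)) !) ≡ n !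
  rhs≡n! = begin
    (n C j) ℕ.* ((n ℕ.∸ j) C t) ℕ.* (j ! ℕ.* t ! ℕ.* (n ℕ.∸ (j ℕ.+ t)) !)
      ≡⟨ solveℕ 5 (λ x y a b c → x ⊛ y ⊛ (a ⊛ b ⊛ c) ≐ x ⊛ (a ⊛ (y ⊛ (b ⊛ c)))) refl
           (n C j) ((n ℕ.∸ j) C t) (j !) (t !) ((n ℕ.∸ (j ℕ.+ t)) !) ⟩
    (n C j) ℕ.* (j ! ℕ.* (((n ℕ.∸ j) C t) ℕ.* (t ! ℕ.* (n ℕ.∸ (j ℕ.+ t)) !)))
      ≡⟨ cong (λ m → (n C j) ℕ.* (j ! ℕ.* (((n ℕ.∸ j) C t) ℕ.* (t ! ℕ.* m !)))) (sym (ℕP.∸-+-assoc n j t)) ⟩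
    (n C j) ℕ.* (j ! ℕ.* (((n ℕ.∸ j) C t) ℕ.* (t ! ℕ.* (n ℕ.∸ j ℕ.∸ t) !)))
      ≡⟨ cong (λ m → (n C j) ℕ.* (j ! ℕ.* m)) (nCk*[k!*[n∸k]!]≡n! t≤n∸j) ⟩
    (n C j) ℕ.* (j ! ℕ.* (n ℕ.∸ j) !)
      ≡⟨ nCk*[k!*[n∸k]!]≡n! j≤n ⟩
    n ! ∎

[1+n]Cn≡1+n : ∀ n → suc n C n ≡ suc n
[1+n]Cn≡1+n n = begin
  suc n C n                 ≡⟨ nCk≡nC[n∸k] (ℕP.n≤1+n n) ⟩
  suc n C (suc n ℕ.∸ n)     ≡⟨ cong (suc n C_) (trans (ℕP.+-∸-assoc 1 (ℕP.≤-refl {n})) (cong suc (ℕP.n∸n≡0 n))) ⟩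
  suc n C 1                 ≡⟨ nC1≡n (suc n) ⟩
  suc n                     ∎

-- Exponential generating functions

Cℚ : ℕ → ℕ → ℚ
Cℚ n j = ℕ→ℚ (n C j)

-- A sequence a stands for the exponential generating function Σ aₙ zⁿ / n!, and _⋆_ is the
-- product of such series. Below, 𝟏, X, exp, expm1, powers x and twist f are the series
-- 1, z, eᶻ, eᶻ - 1, eˣᶻ and f(-z).
infixl 7 _⋆_
_⋆_ : (ℕ → ℚ) → (ℕ → ℚ) → ℕ → ℚ
(f ⋆ g) n = Σ< (suc n) (λ j → Cℚ n j * (f j * g (n ℕ.∸ j)))

⋆-cong : ∀ {f f′ g g′} → f ≗ f′ → g ≗ g′ → f ⋆ g ≗ f′ ⋆ g′
⋆-cong f≗f′ g≗g′ n = Σ<-cong (suc n) (λ j → cong₂ (λ a b → Cℚ n j * (a * b)) (f≗f′ j) (g≗g′ (n ℕ.∸ j)))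

⋆-congˡ : ∀ {f f′} g → f ≗ f′ → f ⋆ g ≗ f′ ⋆ g
⋆-congˡ {f} {f′} g f≗f′ = ⋆-cong {f} {f′} {g} {g} f≗f′ (λ _ → refl)

⋆-congʳ : ∀ f {g g′} → g ≗ g′ → f ⋆ g ≗ f ⋆ g′
⋆-congʳ f {g} {g′} = ⋆-cong {f} {f} {g} {g′} (λ _ → refl)

⋆-comm : ∀ f g → f ⋆ g ≗ g ⋆ f
⋆-comm f g n = trans (Σ<-reverse n _) (Σ<-cong-< (suc n) reflectTerm)
  where
  reflectTerm : ∀ j → j ℕ.< suc n →
    Cℚ n (n ℕ.∸ j) * (f (n ℕ.∸ j) * g (n ℕ.∸ (n ℕ.∸ j))) ≡ Cℚ n j * (g j * f (n ℕ.∸ j))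
  reflectTerm j (s≤s j≤n) = begin
    Cℚ n (n ℕ.∸ j) * (f (n ℕ.∸ j) * g (n ℕ.∸ (n ℕ.∸ j)))
      ≡⟨ cong₂ (λ a b → ℕ→ℚ a * (f (n ℕ.∸ j) * g b)) (sym (nCk≡nC[n∸k] j≤n)) (ℕP.m∸[m∸n]≡n j≤n) ⟩
    Cℚ n j * (f (n ℕ.∸ j) * g j)
      ≡⟨ cong (Cℚ n j *_) (ℚP.*-comm (f (n ℕ.∸ j)) (g j)) ⟩
    Cℚ n j * (g j * f (n ℕ.∸ j)) ∎

⋆-distribʳ-+ : ∀ f f′ g → (λ n → f n + f′ n) ⋆ g ≗ (λ n → (f ⋆ g) n + (f′ ⋆ g) n)
⋆-distribʳ-+ f f′ g n = trans
  (Σ<-cong (suc n) (λ j → solve 4 (λ c a b d → c :* ((a :+ b) :* d) := c :* (a :* d) :+ c :* (b :* d)) refl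
                            (Cℚ n j) (f j) (f′ j) (g (n ℕ.∸ j))))
  (Σ<-+ (suc n) _ _)

⋆-distribˡ-+ : ∀ f g g′ → f ⋆ (λ n → g n + g′ n) ≗ (λ n → (f ⋆ g) n + (f ⋆ g′) n)
⋆-distribˡ-+ f g g′ n = begin
  (f ⋆ (λ n → g n + g′ n)) n    ≡⟨ ⋆-comm f (λ n → g n + g′ n) n ⟩
  ((λ n → g n + g′ n) ⋆ f) n    ≡⟨ ⋆-distribʳ-+ g g′ f n ⟩
  (g ⋆ f) n + (g′ ⋆ f) n        ≡⟨ cong₂ _+_ (⋆-comm g f n) (⋆-comm g′ f n) ⟩
  (f ⋆ g) n + (f ⋆ g′) n        ∎

⋆-scaleˡ : ∀ c f g → (λ n → c * f n) ⋆ g ≗ (λ n → c * (f ⋆ g) n)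
⋆-scaleˡ c f g n = trans
  (Σ<-cong (suc n) (λ j → solve 4 (λ k c a d → k :* ((c :* a) :* d) := c :* (k :* (a :* d))) refl
                            (Cℚ n j) c (f j) (g (n ℕ.∸ j))))
  (Σ<-*ˡ (suc n) c _)

⋆-scaleʳ : ∀ c f g → f ⋆ (λ n → c * g n) ≗ (λ n → c * (f ⋆ g) n)
⋆-scaleʳ c f g n = begin
  (f ⋆ (λ n → c * g n)) n     ≡⟨ ⋆-comm f (λ n → c * g n) n ⟩
  ((λ n → c * g n) ⋆ f) n     ≡⟨ ⋆-scaleˡ c g f n ⟩
  c * (g ⋆ f) n               ≡⟨ cong (c *_) (⋆-comm g f n) ⟩
  c * (f ⋆ g) n               ∎

⋆-assoc : ∀ f g h → (f ⋆ g) ⋆ h ≗ f ⋆ (g ⋆ h)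
⋆-assoc f g h n = begin
  ((f ⋆ g) ⋆ h) n
    ≡⟨ Σ<-cong (suc n) (λ i → trans (cong (Cℚ n i *_) (sym (Σ<-*ʳ (suc i) (h (n ℕ.∸ i)) _)))
                                    (sym (Σ<-*ˡ (suc i) (Cℚ n i) _))) ⟩
  Σ< (suc n) (λ i → Σ< (suc i) (F i))
    ≡⟨ Σ<-triangle n F ⟩
  Σ< (suc n) (λ j → Σ< (suc (n ℕ.∸ j)) (λ t → F (j ℕ.+ t) j))
    ≡⟨ Σ<-cong-< (suc n) (λ j j≤n → Σ<-cong-< (suc (n ℕ.∸ j)) (regroup j j≤n)) ⟩
  Σ< (suc n) (λ j → Σ< (suc (n ℕ.∸ j)) (λ t → Cℚ n j * (f j * (Cℚ (n ℕ.∸ j) t * (g t * h (n ℕ.∸ j ℕ.∸ t))))))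
    ≡⟨ Σ<-cong (suc n) (λ j → trans (Σ<-*ˡ (suc (n ℕ.∸ j)) (Cℚ n j) _)
                                    (cong (Cℚ n j *_) (Σ<-*ˡ (suc (n ℕ.∸ j)) (f j) _))) ⟩
  (f ⋆ (g ⋆ h)) n ∎
  where
  F : ℕ → ℕ → ℚ
  F i j = Cℚ n i * ((Cℚ i j * (f j * g (i ℕ.∸ j))) * h (n ℕ.∸ i))
  regroup : ∀ j → j ℕ.< suc n → ∀ t → t ℕ.< suc (n ℕ.∸ j) →
    F (j ℕ.+ t) j ≡ Cℚ n j * (f j * (Cℚ (n ℕ.∸ j) t * (g t * h (n ℕ.∸ j ℕ.∸ t))))
  regroup j (s≤s j≤n) t (s≤s t≤n∸j) = begin
    Cℚ n (j ℕ.+ t) * ((Cℚ (j ℕ.+ t) j * (f j * g ((j ℕ.+ t) ℕ.∸ j))) * h (n ℕ.∸ (j ℕ.+ t)))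
      ≡⟨ cong₂ (λ a b → Cℚ n (j ℕ.+ t) * ((Cℚ (j ℕ.+ t) j * (f j * g a)) * h b))
               (ℕP.m+n∸m≡n j t) (sym (ℕP.∸-+-assoc n j t)) ⟩
    Cℚ n (j ℕ.+ t) * ((Cℚ (j ℕ.+ t) j * (f j * g t)) * h (n ℕ.∸ j ℕ.∸ t))
      ≡⟨ solve 5 (λ A B a b c → A :* ((B :* (a :* b)) :* c) := (A :* B) :* (a :* (b :* c))) refl
           (Cℚ n (j ℕ.+ t)) (Cℚ (j ℕ.+ t) j) (f j) (g t) (h (n ℕ.∸ j ℕ.∸ t)) ⟩
    (Cℚ n (j ℕ.+ t) * Cℚ (j ℕ.+ t) j) * (f j * (g t * h (n ℕ.∸ j ℕ.∸ t)))
      ≡⟨ cong (_* (f j * (g t * h (n ℕ.∸ j ℕ.∸ t)))) binomials ⟩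
    (Cℚ n j * Cℚ (n ℕ.∸ j) t) * (f j * (g t * h (n ℕ.∸ j ℕ.∸ t)))
      ≡⟨ solve 5 (λ A B a b c → (A :* B) :* (a :* (b :* c)) := A :* (a :* (B :* (b :* c)))) refl
           (Cℚ n j) (Cℚ (n ℕ.∸ j) t) (f j) (g t) (h (n ℕ.∸ j ℕ.∸ t)) ⟩
    Cℚ n j * (f j * (Cℚ (n ℕ.∸ j) t * (g t * h (n ℕ.∸ j ℕ.∸ t)))) ∎
    where
    j+t≤n : j ℕ.+ t ℕ.≤ n
    j+t≤n = subst (j ℕ.+ t ℕ.≤_) (ℕP.m+[n∸m]≡n j≤n) (ℕP.+-monoʳ-≤ j t≤n∸j)
    binomials : Cℚ n (j ℕ.+ t) * Cℚ (j ℕ.+ t) j ≡ Cℚ n j * Cℚ (n ℕ.∸ j) t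
    binomials = begin
      Cℚ n (j ℕ.+ t) * Cℚ (j ℕ.+ t) j                 ≡⟨ ℕ→ℚ-* (n C (j ℕ.+ t)) _ ⟨
      ℕ→ℚ ((n C (j ℕ.+ t)) ℕ.* ((j ℕ.+ t) C j))       ≡⟨ cong ℕ→ℚ (nC[j+t]*[j+t]Cj≡nCj*[n∸j]Ct j t j+t≤n) ⟩
      ℕ→ℚ ((n C j) ℕ.* ((n ℕ.∸ j) C t))               ≡⟨ ℕ→ℚ-* (n C j) _ ⟩
      Cℚ n j * Cℚ (n ℕ.∸ j) t                         ∎

𝟏 : ℕ → ℚ
𝟏 zero = 1ℚ
𝟏 (suc _) = 0ℚ

X : ℕ → ℚ
X (suc zero) = 1ℚ
X _ = 0ℚ

exp : ℕ → ℚ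
exp _ = 1ℚ

expm1 : ℕ → ℚ
expm1 zero = 0ℚ
expm1 (suc _) = 1ℚ

powers : ℚ → ℕ → ℚ
powers x n = x ^ℚ n

twist : (ℕ → ℚ) → ℕ → ℚ
twist f n = (-1ℚ ^ℚ n) * f n

⋆-identityˡ : ∀ f → 𝟏 ⋆ f ≗ f
⋆-identityˡ f n = trans (Σ<-single (suc n) 0 _ (s≤s z≤n) vanish) 
  (solve 1 (λ a → con 1ℚ :* (con 1ℚ :* a) := a) refl (f n))
  where
  vanish : ∀ i → i ℕ.< suc n → i ≢ 0 → Cℚ n i * (𝟏 i * f (n ℕ.∸ i)) ≡ 0ℚ
  vanish zero _ 0≢0 = ⊥-elim (0≢0 refl)
  vanish (suc i) _ _ = solve 2 (λ a b → a :* (con 0ℚ :* b) := con 0ℚ) refl (Cℚ n (suc i)) (f (n ℕ.∸ suc i))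

⋆-identityʳ : ∀ f → f ⋆ 𝟏 ≗ f
⋆-identityʳ f n = trans (⋆-comm f 𝟏 n) (⋆-identityˡ f n)

X⋆-suc : ∀ f n → (X ⋆ f) (suc n) ≡ ℕ→ℚ (suc n) * f n
X⋆-suc f n = trans (Σ<-single (suc (suc n)) 1 _ (s≤s (s≤s z≤n)) vanish)
  (cong₂ (λ c a → ℕ→ℚ c * a) (nC1≡n (suc n)) (ℚP.*-identityˡ (f n)))
  where
  vanish : ∀ i → i ℕ.< suc (suc n) → i ≢ 1 → Cℚ (suc n) i * (X i * f (suc n ℕ.∸ i)) ≡ 0ℚ
  vanish zero _ _ = solve 2 (λ a b → a :* (con 0ℚ :* b) := con 0ℚ) refl (Cℚ (suc n) 0) (f (suc n))
  vanish (suc zero) _ 1≢1 = ⊥-elim (1≢1 refl)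
  vanish (suc (suc i)) _ _ =
    solve 2 (λ a b → a :* (con 0ℚ :* b) := con 0ℚ) refl (Cℚ (suc n) (suc (suc i))) (f (suc n ℕ.∸ suc (suc i)))

X⋆exp≗ℕ→ℚ : X ⋆ exp ≗ ℕ→ℚ
X⋆exp≗ℕ→ℚ zero = refl
X⋆exp≗ℕ→ℚ (suc n) = trans (X⋆-suc exp n) (ℚP.*-identityʳ _)

⋆-leibniz : ∀ f g n → (f ⋆ g) (suc n) ≡ ((f ∘ suc) ⋆ g) n + (f ⋆ (g ∘ suc)) n
⋆-leibniz f g n = begin
  (f ⋆ g) (suc n)
    ≡⟨ Σ<-head (suc n) term ⟩
  term 0 + Σ< (suc n) (term ∘ suc)
    ≡⟨ cong (_+_ (term 0)) (trans (Σ<-cong (suc n) pascal) (Σ<-+ (suc n) low high)) ⟩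
  term 0 + (((f ∘ suc) ⋆ g) n + (Σ< n high + high n))
    ≡⟨ cong (λ h → term 0 + (((f ∘ suc) ⋆ g) n + (Σ< n high + h))) highₙ≡0 ⟩
  term 0 + (((f ∘ suc) ⋆ g) n + (Σ< n high + 0ℚ))
    ≡⟨ solve 3 (λ t l h → t :+ (l :+ (h :+ con 0ℚ)) := l :+ (t :+ h)) refl (term 0) (((f ∘ suc) ⋆ g) n) (Σ< n high) ⟩
  ((f ∘ suc) ⋆ g) n + (term 0 + Σ< n high)
    ≡⟨ cong (_+_ (((f ∘ suc) ⋆ g) n)) (trans (cong (_+_ (term 0)) (Σ<-cong-< n shifted)) (sym (Σ<-head n _))) ⟩
  ((f ∘ suc) ⋆ g) n + (f ⋆ (g ∘ suc)) n ∎
  where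
  term low high : ℕ → ℚ
  term j = Cℚ (suc n) j * (f j * g (suc n ℕ.∸ j))
  low j = Cℚ n j * (f (suc j) * g (n ℕ.∸ j))
  high j = Cℚ n (suc j) * (f (suc j) * g (n ℕ.∸ j))
  pascal : ∀ j → term (suc j) ≡ low j + high j
  pascal j = begin
    ℕ→ℚ (suc n C suc j) * (f (suc j) * g (n ℕ.∸ j))
      ≡⟨ cong (λ c → ℕ→ℚ c * (f (suc j) * g (n ℕ.∸ j))) (sym (nCk+nC[k+1]≡[n+1]C[k+1] n j)) ⟩
    ℕ→ℚ (n C j ℕ.+ n C suc j) * (f (suc j) * g (n ℕ.∸ j))
      ≡⟨ cong (_* (f (suc j) * g (n ℕ.∸ j))) (ℕ→ℚ-+ (n C j) (n C suc j)) ⟩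
    (Cℚ n j + Cℚ n (suc j)) * (f (suc j) * g (n ℕ.∸ j))
      ≡⟨ ℚP.*-distribʳ-+ _ (Cℚ n j) (Cℚ n (suc j)) ⟩
    low j + high j ∎
  highₙ≡0 : high n ≡ 0ℚ
  highₙ≡0 = trans (cong (λ c → ℕ→ℚ c * (f (suc n) * g (n ℕ.∸ n))) (k>n⇒nCk≡0 (ℕP.n<1+n n)))
                  (ℚP.*-zeroˡ (f (suc n) * g (n ℕ.∸ n)))
  shifted : ∀ j → j ℕ.< n → high j ≡ Cℚ n (suc j) * (f (suc j) * g (suc (n ℕ.∸ suc j)))
  shifted j j<n = cong (λ m → Cℚ n (suc j) * (f (suc j) * g m)) (ℕP.+-∸-assoc 1 j<n)

powers-⋆ : ∀ x y → powers x ⋆ powers y ≗ powers (x + y)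
powers-⋆ x y zero = refl
powers-⋆ x y (suc n) = begin
  (powers x ⋆ powers y) (suc n)
    ≡⟨ ⋆-leibniz (powers x) (powers y) n ⟩
  ((λ m → x * powers x m) ⋆ powers y) n + (powers x ⋆ (λ m → y * powers y m)) n
    ≡⟨ cong₂ _+_ (⋆-scaleˡ x (powers x) (powers y) n) (⋆-scaleʳ y (powers x) (powers y) n) ⟩
  x * (powers x ⋆ powers y) n + y * (powers x ⋆ powers y) n
    ≡⟨ ℚP.*-distribʳ-+ _ x y ⟨
  (x + y) * (powers x ⋆ powers y) n
    ≡⟨ cong ((x + y) *_) (powers-⋆ x y n) ⟩
  (x + y) ^ℚ suc n ∎

twist-⋆ : ∀ f g → twist (f ⋆ g) ≗ twist f ⋆ twist g
twist-⋆ f g n = trans (sym (Σ<-*ˡ (suc n) (-1ℚ ^ℚ n) _)) (Σ<-cong-< (suc n) splitSign)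
  where
  splitSign : ∀ j → j ℕ.< suc n → (-1ℚ ^ℚ n) * (Cℚ n j * (f j * g (n ℕ.∸ j)))
    ≡ Cℚ n j * (((-1ℚ ^ℚ j) * f j) * ((-1ℚ ^ℚ (n ℕ.∸ j)) * g (n ℕ.∸ j)))
  splitSign j (s≤s j≤n) = begin
    (-1ℚ ^ℚ n) * (Cℚ n j * (f j * g (n ℕ.∸ j)))
      ≡⟨ cong (λ m → (-1ℚ ^ℚ m) * (Cℚ n j * (f j * g (n ℕ.∸ j)))) (sym (ℕP.m+[n∸m]≡n j≤n)) ⟩
    (-1ℚ ^ℚ (j ℕ.+ (n ℕ.∸ j))) * (Cℚ n j * (f j * g (n ℕ.∸ j)))
      ≡⟨ cong (_* (Cℚ n j * (f j * g (n ℕ.∸ j)))) (^ℚ-+ -1ℚ j (n ℕ.∸ j)) ⟩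
    ((-1ℚ ^ℚ j) * (-1ℚ ^ℚ (n ℕ.∸ j))) * (Cℚ n j * (f j * g (n ℕ.∸ j)))
      ≡⟨ solve 5 (λ a b c u v → (a :* b) :* (c :* (u :* v)) := c :* ((a :* u) :* (b :* v))) refl
           (-1ℚ ^ℚ j) (-1ℚ ^ℚ (n ℕ.∸ j)) (Cℚ n j) (f j) (g (n ℕ.∸ j)) ⟩
    Cℚ n j * (((-1ℚ ^ℚ j) * f j) * ((-1ℚ ^ℚ (n ℕ.∸ j)) * g (n ℕ.∸ j))) ∎

⋆expm1-suc : ∀ f n → (f ⋆ expm1) (suc n) ≡ Σ< (suc n) (λ j → Cℚ (suc n) j * f j)
⋆expm1-suc f n = begin
  Σ< (suc n) (λ j → Cℚ (suc n) j * (f j * expm1 (suc n ℕ.∸ j))) + Cℚ (suc n) (suc n) * (f (suc n) * expm1 (n ℕ.∸ n))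
    ≡⟨ cong₂ _+_ (Σ<-cong-< (suc n) dropOne) (cong (λ m → Cℚ (suc n) (suc n) * (f (suc n) * expm1 m)) (ℕP.n∸n≡0 n)) ⟩
  Σ< (suc n) (λ j → Cℚ (suc n) j * f j) + Cℚ (suc n) (suc n) * (f (suc n) * 0ℚ)
    ≡⟨ solve 3 (λ s c a → s :+ c :* (a :* con 0ℚ) := s) refl _ (Cℚ (suc n) (suc n)) (f (suc n)) ⟩
  Σ< (suc n) (λ j → Cℚ (suc n) j * f j) ∎
  where
  dropOne : ∀ j → j ℕ.< suc n → Cℚ (suc n) j * (f j * expm1 (suc n ℕ.∸ j)) ≡ Cℚ (suc n) j * f j
  dropOne j (s≤s j≤n) = trans (cong (λ m → Cℚ (suc n) j * (f j * expm1 m)) (ℕP.+-∸-assoc 1 j≤n))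
                              (cong (Cℚ (suc n) j *_) (ℚP.*-identityʳ (f j)))

-- Coefficient n + 1 of f ⋆ expm1 is (n + 1) fₙ plus a combination of the earlier fⱼ.
⋆-cancelʳ-expm1 : ∀ f g → f ⋆ expm1 ≗ g ⋆ expm1 → f ≗ g
⋆-cancelʳ-expm1 f g eq n = agreeBelow (suc n) n ℕP.≤-refl
  where
  agreeBelow : ∀ m j → j ℕ.< m → f j ≡ g j
  agreeBelow (suc m) j j<1+m with j ℕ.≟ m
  ... | no j≢m = agreeBelow m j (ℕP.≤∧≢⇒< (ℕP.≤-pred j<1+m) j≢m)
  ... | yes refl = *-cancelˡ-ℕ→ℚ (suc j) (begin
    ℕ→ℚ (suc j) * f j         ≡⟨ cong (λ c → ℕ→ℚ c * f j) ([1+n]Cn≡1+n j) ⟨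
    Cℚ (suc j) j * f j        ≡⟨ +-cancelˡ (trans (sym (⋆expm1-suc f j)) (trans (eq (suc j)) (⋆expm1-suc g j))) ⟩
    Cℚ (suc j) j * g j        ≡⟨ cong (λ c → ℕ→ℚ c * g j) ([1+n]Cn≡1+n j) ⟩
    ℕ→ℚ (suc j) * g j         ∎)
    where
    earlier : Σ< j (λ i → Cℚ (suc j) i * f i) ≡ Σ< j (λ i → Cℚ (suc j) i * g i)
    earlier = Σ<-cong-< j (λ i i<j → cong (Cℚ (suc j) i *_) (agreeBelow j i i<j))
    +-cancelˡ : ∀ {x y} → Σ< j (λ i → Cℚ (suc j) i * f i) + x ≡ Σ< j (λ i → Cℚ (suc j) i * g i) + y → x ≡ y
    +-cancelˡ {x} {y} eq′ = +-cancelˡ-ℚ (Σ< j (λ i → Cℚ (suc j) i * f i)) x y (trans eq′ (cong (_+ y) (sym earlier)))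

bernUpTo-stable : ∀ m i → i ℕ.≤ m → bernUpTo m i ≡ B i
bernUpTo-stable zero zero z≤n = refl
bernUpTo-stable (suc m) i i≤1+m with i ℕ.≟ suc m
... | yes refl = refl
... | no i≢1+m = below (ℕP.≤-pred (ℕP.≤∧≢⇒< i≤1+m i≢1+m))
  where
  below : i ℕ.≤ m → bernUpTo (suc m) i ≡ B i
  below i≤m rewrite Equivalence.to T-≡ (ℕP.≤⇒≤ᵇ i≤m) = bernUpTo-stable m i i≤m

m≤n⇒n<ᵇm≡false : ∀ {m n} → m ℕ.≤ n → (n <ᵇ m) ≡ false
m≤n⇒n<ᵇm≡false {m} {n} m≤n with n <ᵇ m in eq
... | false = refl
... | true = ⊥-elim (ℕP.<⇒≱ (ℕP.<ᵇ⇒< n m (subst T (sym eq) _)) m≤n)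

B-suc : ∀ m → B (suc m) ≡ ((+ 1) ℚ./ suc (suc m)) *
  (ℕ→ℚ (suc (suc m)) - Σ< (suc m) (λ i → Cℚ (suc (suc m)) i * bernUpTo m i))
B-suc m rewrite m≤n⇒n<ᵇm≡false (ℕP.≤-refl {m}) = refl

B-recursion : ∀ n → Σ< (suc n) (λ j → Cℚ (suc n) j * B j) ≡ ℕ→ℚ (suc n)
B-recursion zero = refl
B-recursion (suc m) = begin
  S + Cℚ (suc (suc m)) (suc m) * B (suc m)
    ≡⟨ cong₂ (λ c b → S + ℕ→ℚ c * b) ([1+n]Cn≡1+n (suc m)) (B-suc m) ⟩
  S + N * (c * (N - Σ< (suc m) (λ i → Cℚ (suc (suc m)) i * bernUpTo m i)))
    ≡⟨ cong (λ z → S + N * (c * (N - z)))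
            (Σ<-cong-< (suc m) (λ i i≤m → cong (Cℚ (suc (suc m)) i *_) (bernUpTo-stable m i (ℕP.≤-pred i≤m)))) ⟩
  S + N * (c * (N - S))
    ≡⟨ cong (_+_ S) (trans (sym (ℚP.*-assoc N c _)) (cong (_* (N - S)) (trans (ℚP.*-comm N c) (1/n*n≡1 (suc (suc m)))))) ⟩
  S + 1ℚ * (N - S)
    ≡⟨ solve 2 (λ s n → s :+ con 1ℚ :* (n :- s) := n) refl S N ⟩
  N ∎
  where
  S = Σ< (suc m) (λ j → Cℚ (suc (suc m)) j * B j)
  N = ℕ→ℚ (suc (suc m))
  c = (+ 1) ℚ./ suc (suc m)

B⋆expm1≗ℕ→ℚ : B ⋆ expm1 ≗ ℕ→ℚ
B⋆expm1≗ℕ→ℚ zero = refl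
B⋆expm1≗ℕ→ℚ (suc n) = trans (⋆expm1-suc B n) (B-recursion n)

powers-1≗exp : powers 1ℚ ≗ exp
powers-1≗exp = 1^ℚn≡1

powers-0≗𝟏 : powers 0ℚ ≗ 𝟏
powers-0≗𝟏 zero = refl
powers-0≗𝟏 (suc n) = ℚP.*-zeroˡ (0ℚ ^ℚ n)

twist-exp⋆exp≗𝟏 : twist exp ⋆ exp ≗ 𝟏
twist-exp⋆exp≗𝟏 n = begin
  (twist exp ⋆ exp) n               ≡⟨ ⋆-cong (λ m → ℚP.*-identityʳ (-1ℚ ^ℚ m)) (sym ∘ powers-1≗exp) n ⟩
  (powers -1ℚ ⋆ powers 1ℚ) n        ≡⟨ powers-⋆ -1ℚ 1ℚ n ⟩
  powers 0ℚ n                       ≡⟨ powers-0≗𝟏 n ⟩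
  𝟏 n                               ∎

twist-expm1⋆exp : twist expm1 ⋆ exp ≗ (λ n → -1ℚ * expm1 n)
twist-expm1⋆exp n = begin
  (twist expm1 ⋆ exp) n
    ≡⟨ ⋆-congˡ exp twist-expm1 n ⟩
  ((λ m → twist exp m + -1ℚ * 𝟏 m) ⋆ exp) n
    ≡⟨ ⋆-distribʳ-+ (twist exp) (λ m → -1ℚ * 𝟏 m) exp n ⟩
  (twist exp ⋆ exp) n + ((λ m → -1ℚ * 𝟏 m) ⋆ exp) n
    ≡⟨ cong₂ _+_ (twist-exp⋆exp≗𝟏 n) (trans (⋆-scaleˡ -1ℚ 𝟏 exp n) (cong (-1ℚ *_) (⋆-identityˡ exp n))) ⟩
  𝟏 n + -1ℚ * exp n
    ≡⟨ 𝟏-exp n ⟩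
  -1ℚ * expm1 n ∎
  where
  twist-expm1 : twist expm1 ≗ (λ m → twist exp m + -1ℚ * 𝟏 m)
  twist-expm1 zero = refl
  twist-expm1 (suc m) = solve 1 (λ s → s :* con 1ℚ := s :* con 1ℚ :+ con -1ℚ :* con 0ℚ) refl (-1ℚ ^ℚ suc m)
  𝟏-exp : ∀ m → 𝟏 m + -1ℚ * exp m ≡ -1ℚ * expm1 m
  𝟏-exp zero = refl
  𝟏-exp (suc m) = refl

twist-X : twist X ≗ (λ n → -1ℚ * X n)
twist-X zero = refl
twist-X (suc zero) = refl
twist-X (suc (suc n)) = solve 1 (λ s → s :* con 0ℚ := con -1ℚ :* con 0ℚ) refl (-1ℚ ^ℚ suc (suc n))

-1*-injective : ∀ {a b} → -1ℚ * a ≡ -1ℚ * b → a ≡ b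
-1*-injective {a} {b} eq = begin
  a                   ≡⟨ solve 1 (λ a → a := con -1ℚ :* (con -1ℚ :* a)) refl a ⟩
  -1ℚ * (-1ℚ * a)     ≡⟨ cong (-1ℚ *_) eq ⟩
  -1ℚ * (-1ℚ * b)     ≡⟨ solve 1 (λ b → con -1ℚ :* (con -1ℚ :* b) := b) refl b ⟩
  b                   ∎

-- Substituting -z into B(z)(eᶻ - 1) = z eᶻ and multiplying by eᶻ gives B(-z)(eᶻ - 1) = z.
twist-B⋆expm1≗X : twist B ⋆ expm1 ≗ X
twist-B⋆expm1≗X n = -1*-injective (begin
  -1ℚ * (twist B ⋆ expm1) n
    ≡⟨ ⋆-scaleʳ -1ℚ (twist B) expm1 n ⟨
  (twist B ⋆ (λ m → -1ℚ * expm1 m)) n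
    ≡⟨ ⋆-congʳ (twist B) twist-expm1⋆exp n ⟨
  (twist B ⋆ (twist expm1 ⋆ exp)) n
    ≡⟨ ⋆-assoc (twist B) (twist expm1) exp n ⟨
  ((twist B ⋆ twist expm1) ⋆ exp) n
    ≡⟨ ⋆-congˡ exp (λ m → trans (sym (twist-⋆ B expm1 m)) (cong ((-1ℚ ^ℚ m) *_) (B⋆expm1≗ℕ→ℚ m))) n ⟩
  (twist ℕ→ℚ ⋆ exp) n
    ≡⟨ ⋆-congˡ exp (λ m → trans (cong ((-1ℚ ^ℚ m) *_) (sym (X⋆exp≗ℕ→ℚ m))) (twist-⋆ X exp m)) n ⟩
  ((twist X ⋆ twist exp) ⋆ exp) n
    ≡⟨ ⋆-assoc (twist X) (twist exp) exp n ⟩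
  (twist X ⋆ (twist exp ⋆ exp)) n
    ≡⟨ trans (⋆-congʳ (twist X) twist-exp⋆exp≗𝟏 n) (⋆-identityʳ (twist X) n) ⟩
  twist X n
    ≡⟨ twist-X n ⟩
  -1ℚ * X n ∎)

-- (B(-z) eᶻ)(eᶻ - 1) = z eᶻ = B(z)(eᶻ - 1); now cancel eᶻ - 1.
twist-B⋆exp≗B : twist B ⋆ exp ≗ B
twist-B⋆exp≗B = ⋆-cancelʳ-expm1 (twist B ⋆ exp) B λ n → begin
  ((twist B ⋆ exp) ⋆ expm1) n        ≡⟨ ⋆-assoc (twist B) exp expm1 n ⟩
  (twist B ⋆ (exp ⋆ expm1)) n        ≡⟨ ⋆-congʳ (twist B) (⋆-comm exp expm1) n ⟩
  (twist B ⋆ (expm1 ⋆ exp)) n        ≡⟨ ⋆-assoc (twist B) expm1 exp n ⟨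
  ((twist B ⋆ expm1) ⋆ exp) n        ≡⟨ ⋆-congˡ exp twist-B⋆expm1≗X n ⟩
  (X ⋆ exp) n                        ≡⟨ X⋆exp≗ℕ→ℚ n ⟩
  ℕ→ℚ n                              ≡⟨ B⋆expm1≗ℕ→ℚ n ⟨
  (B ⋆ expm1) n                      ∎

B≗twist-B+X : B ≗ (λ n → twist B n + X n)
B≗twist-B+X n = begin
  B n                                           ≡⟨ twist-B⋆exp≗B n ⟨
  (twist B ⋆ exp) n                             ≡⟨ ⋆-congʳ (twist B) exp≗𝟏+expm1 n ⟩
  (twist B ⋆ (λ m → 𝟏 m + expm1 m)) n           ≡⟨ ⋆-distribˡ-+ (twist B) 𝟏 expm1 n ⟩
  (twist B ⋆ 𝟏) n + (twist B ⋆ expm1) n         ≡⟨ cong₂ _+_ (⋆-identityʳ (twist B) n) (twist-B⋆expm1≗X n) ⟩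
  twist B n + X n                               ∎
  where
  exp≗𝟏+expm1 : exp ≗ (λ m → 𝟏 m + expm1 m)
  exp≗𝟏+expm1 zero = refl
  exp≗𝟏+expm1 (suc m) = refl

-- Faulhaber's formula

-- bernPoly n is the Bernoulli polynomial Bₙ(y) (with the usual B₁ = -1/2 convention).
bernPoly : ℕ → ℚ → ℚ
bernPoly n y = (twist B ⋆ powers y) n

bernPoly-1+≡B⋆powers : ∀ n y → bernPoly n (1ℚ + y) ≡ (B ⋆ powers y) n
bernPoly-1+≡B⋆powers n y = begin
  (twist B ⋆ powers (1ℚ + y)) n           ≡⟨ ⋆-congʳ (twist B) (powers-⋆ 1ℚ y) n ⟨
  (twist B ⋆ (powers 1ℚ ⋆ powers y)) n    ≡⟨ ⋆-assoc (twist B) (powers 1ℚ) (powers y) n ⟨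
  ((twist B ⋆ powers 1ℚ) ⋆ powers y) n    ≡⟨ ⋆-congˡ (powers y) twist-B⋆powers-1≗B n ⟩
  (B ⋆ powers y) n                        ∎
  where
  twist-B⋆powers-1≗B : twist B ⋆ powers 1ℚ ≗ B
  twist-B⋆powers-1≗B m = trans (⋆-congʳ (twist B) powers-1≗exp m) (twist-B⋆exp≗B m)

bernPoly-1+ : ∀ k y → bernPoly (suc k) (1ℚ + y) ≡ bernPoly (suc k) y + ℕ→ℚ (suc k) * y ^ℚ k
bernPoly-1+ k y = begin
  bernPoly (suc k) (1ℚ + y)                               ≡⟨ bernPoly-1+≡B⋆powers (suc k) y ⟩
  (B ⋆ powers y) (suc k)                                  ≡⟨ ⋆-congˡ (powers y) B≗twist-B+X (suc k) ⟩
  ((λ m → twist B m + X m) ⋆ powers y) (suc k)            ≡⟨ ⋆-distribʳ-+ (twist B) X (powers y) (suc k) ⟩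
  bernPoly (suc k) y + (X ⋆ powers y) (suc k)             ≡⟨ cong (_+_ (bernPoly (suc k) y)) (X⋆-suc (powers y) k) ⟩
  bernPoly (suc k) y + ℕ→ℚ (suc k) * y ^ℚ k               ∎

power-sum-telescope : ∀ k x n →
  ℕ→ℚ (suc k) * Σ< n (λ i → ℕ→ℚ (suc (x ℕ.+ i)) ^ℚ k)
    ≡ bernPoly (suc k) (ℕ→ℚ (suc (x ℕ.+ n))) - bernPoly (suc k) (ℕ→ℚ (suc x))
power-sum-telescope k x zero rewrite ℕP.+-identityʳ x =
  solve 2 (λ c b → c :* con 0ℚ := b :- b) refl (ℕ→ℚ (suc k)) (bernPoly (suc k) (ℕ→ℚ (suc x)))
power-sum-telescope k x (suc n) = begin
  ℕ→ℚ (suc k) * (Σ< n P + P n)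
    ≡⟨ ℚP.*-distribˡ-+ (ℕ→ℚ (suc k)) (Σ< n P) (P n) ⟩
  ℕ→ℚ (suc k) * Σ< n P + ℕ→ℚ (suc k) * P n
    ≡⟨ cong (_+ ℕ→ℚ (suc k) * P n) (power-sum-telescope k x n) ⟩
  (bernPoly (suc k) y - bernPoly (suc k) y₀) + ℕ→ℚ (suc k) * P n
    ≡⟨ solve 3 (λ a b c → (a :- b) :+ c := (a :+ c) :- b) refl
         (bernPoly (suc k) y) (bernPoly (suc k) y₀) (ℕ→ℚ (suc k) * P n) ⟩
  (bernPoly (suc k) y + ℕ→ℚ (suc k) * y ^ℚ k) - bernPoly (suc k) y₀
    ≡⟨ cong (_- bernPoly (suc k) y₀) (sym (bernPoly-1+ k y)) ⟩
  bernPoly (suc k) (1ℚ + y) - bernPoly (suc k) y₀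
    ≡⟨ cong (λ m → bernPoly (suc k) m - bernPoly (suc k) y₀)
            (trans (sym (ℕ→ℚ-suc (suc (x ℕ.+ n)))) (cong (ℕ→ℚ ∘ suc) (sym (ℕP.+-suc x n)))) ⟩
  bernPoly (suc k) (ℕ→ℚ (suc (x ℕ.+ suc n))) - bernPoly (suc k) y₀ ∎
  where
  P : ℕ → ℚ
  P i = ℕ→ℚ (suc (x ℕ.+ i)) ^ℚ k
  y = ℕ→ℚ (suc (x ℕ.+ n))
  y₀ = ℕ→ℚ (suc x)

faulhaber : ∀ k x n → Σ< n (λ i → ℕ→ℚ (suc (x ℕ.+ i)) ^ℚ k)
  ≡ bernSum k (λ j → (-1ℚ ^ℚ j) * ℕ→ℚ (suc (x ℕ.+ n)) ^ℚ (suc k ℕ.∸ j) - ℕ→ℚ x ^ℚ (suc k ℕ.∸ j))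
faulhaber k x n = begin
  S                                                       ≡⟨ 1/n*[n*a]≡a (suc k) S ⟨
  c * (ℕ→ℚ (suc k) * S)                                   ≡⟨ cong (c *_) (power-sum-telescope k x n) ⟩
  c * (bernPoly (suc k) y - bernPoly (suc k) (ℕ→ℚ (suc x)))
    ≡⟨ cong (λ z → c * (bernPoly (suc k) y - z))
            (trans (cong (bernPoly (suc k)) (ℕ→ℚ-suc x)) (bernPoly-1+≡B⋆powers (suc k) (ℕ→ℚ x))) ⟩
  c * ((twist B ⋆ powers y) (suc k) - (B ⋆ powers (ℕ→ℚ x)) (suc k))
    ≡⟨ cong (c *_) (trans (Σ<-cong (suc (suc k)) expand) (Σ<-- (suc (suc k)) _ _)) ⟨
  bernSum k (λ j → (-1ℚ ^ℚ j) * y ^ℚ (suc k ℕ.∸ j) - ℕ→ℚ x ^ℚ (suc k ℕ.∸ j)) ∎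
  where
  S = Σ< n (λ i → ℕ→ℚ (suc (x ℕ.+ i)) ^ℚ k)
  c = (+ 1) ℚ./ suc k
  y = ℕ→ℚ (suc (x ℕ.+ n))
  expand : ∀ j → Cℚ (suc k) j * B j * ((-1ℚ ^ℚ j) * y ^ℚ (suc k ℕ.∸ j) - ℕ→ℚ x ^ℚ (suc k ℕ.∸ j))
    ≡ Cℚ (suc k) j * (twist B j * y ^ℚ (suc k ℕ.∸ j)) - Cℚ (suc k) j * (B j * ℕ→ℚ x ^ℚ (suc k ℕ.∸ j))
  expand j = solve 5 (λ C b s u v → C :* b :* (s :* u :- v) := C :* ((s :* b) :* u) :- C :* (b :* v)) refl
    (Cℚ (suc k) j) (B j) (-1ℚ ^ℚ j) (y ^ℚ (suc k ℕ.∸ j)) (ℕ→ℚ x ^ℚ (suc k ℕ.∸ j))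

-- Truncated multiple harmonic sums

invPow-neg : ∀ i k → invPow i (- (+ k)) ≡ ℕ→ℚ (suc i) ^ℚ k
invPow-neg i zero = refl
invPow-neg i (suc k) = ℕ→ℚ-^ (suc i) (suc k)

invPow-∸1 : ∀ i l → invPow i (l ℤ.- + 1) ≡ invPow i l * ℕ→ℚ (suc i)
invPow-∸1 i (+ zero) = trans (ℕ→ℚ-^ (suc i) 1) (ℚP.*-comm (ℕ→ℚ (suc i)) 1ℚ)
invPow-∸1 i (+ suc n) = begin
  a                               ≡⟨ 1/n*[n*a]≡a ((suc i) ℕ.^ suc n) {{ℕP.m^n≢0 (suc i) (suc n)}} a ⟨
  b * (N^ (suc n) * a)            ≡⟨ cong (λ z → b * (z * a)) (ℕ→ℚ-* (suc i) (suc i ℕ.^ n)) ⟩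
  b * (N * N^ n * a)              ≡⟨ solve 4 (λ a b y z → b :* (y :* z :* a) := b :* y :* (z :* a)) refl a b N (N^ n) ⟩
  b * N * (N^ n * a)              ≡⟨ cong (b * N *_) (ℚP.*-comm (N^ n) a) ⟩
  b * N * (a * N^ n)              ≡⟨ cong (b * N *_) (1/n*n≡1 ((suc i) ℕ.^ n) {{ℕP.m^n≢0 (suc i) n}}) ⟩
  b * N * 1ℚ                      ≡⟨ ℚP.*-identityʳ (b * N) ⟩
  b * N                           ∎
  where
  N = ℕ→ℚ (suc i)
  N^ : ℕ → ℚ
  N^ m = ℕ→ℚ (suc i ℕ.^ m)
  a = invPow i (+ n)
  b = invPow i (+ suc n)
invPow-∸1 i -[1+ n ] = begin
  ℕ→ℚ (suc i ℕ.^ suc (suc (n ℕ.+ 0)))     ≡⟨ cong (λ m → ℕ→ℚ (suc i ℕ.^ suc (suc m))) (ℕP.+-identityʳ n) ⟩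
  ℕ→ℚ (suc i ℕ.* suc i ℕ.^ suc n)         ≡⟨ ℕ→ℚ-* (suc i) (suc i ℕ.^ suc n) ⟩
  ℕ→ℚ (suc i) * ℕ→ℚ (suc i ℕ.^ suc n)     ≡⟨ ℚP.*-comm (ℕ→ℚ (suc i)) _ ⟩
  ℕ→ℚ (suc i ℕ.^ suc n) * ℕ→ℚ (suc i)     ∎

invPow-∸ : ∀ i l m → invPow i (l ℤ.- + m) ≡ invPow i l * ℕ→ℚ (suc i) ^ℚ m
invPow-∸ i l zero = trans (cong (invPow i) (ℤP.+-identityʳ l)) (sym (ℚP.*-identityʳ _))
invPow-∸ i l (suc m) = begin
  invPow i (l ℤ.- + suc m)                         ≡⟨ cong (invPow i) l-[1+m]≡l-m-1 ⟩
  invPow i ((l ℤ.- + m) ℤ.- + 1)                   ≡⟨ invPow-∸1 i (l ℤ.- + m) ⟩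
  invPow i (l ℤ.- + m) * N                         ≡⟨ cong (_* N) (invPow-∸ i l m) ⟩
  invPow i l * N ^ℚ m * N
    ≡⟨ solve 3 (λ a p y → a :* p :* y := a :* (y :* p)) refl (invPow i l) (N ^ℚ m) N ⟩
  invPow i l * N ^ℚ suc m                          ∎
  where
  open ℤSolver using (_⊕_; _⊝_; _≐_) renaming (solve to solveℤ)
  N = ℕ→ℚ (suc i)
  l-[1+m]≡l-m-1 : l ℤ.- + suc m ≡ (l ℤ.- + m) ℤ.- + 1
  l-[1+m]≡l-m-1 = trans (cong (ℤ._-_ l) (ℤP.pos-+ 1 m))
    (solveℤ 3 (λ l o m → l ⊝ (o ⊕ m) ≐ (l ⊝ m) ⊝ o) refl l (+ 1) (+ m))

sh≡∸ : ∀ a k j → j ℕ.≤ suc k → sh a k j ≡ a ℤ.- + (suc k ℕ.∸ j)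
sh≡∸ a k j j≤1+k = begin
  a ℤ.- + k ℤ.- + 1 ℤ.+ + j
    ≡⟨ solveℤ 4 (λ a k o j → a ⊝ k ⊝ o ⊕ j ≐ a ⊝ (k ⊕ o) ⊕ j) refl a (+ k) (+ 1) (+ j) ⟩
  a ℤ.- (+ k ℤ.+ + 1) ℤ.+ + j   ≡⟨ cong (λ z → a ℤ.- z ℤ.+ + j) k+1≡m+j ⟩
  a ℤ.- (+ m ℤ.+ + j) ℤ.+ + j   ≡⟨ solveℤ 3 (λ a m j → a ⊝ (m ⊕ j) ⊕ j ≐ a ⊝ m) refl a (+ m) (+ j) ⟩
  a ℤ.- + m                     ∎
  where
  open ℤSolver using (_⊕_; _⊝_; _≐_) renaming (solve to solveℤ)
  m = suc k ℕ.∸ j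
  k+1≡m+j : + k ℤ.+ + 1 ≡ + m ℤ.+ + j
  k+1≡m+j = trans (sym (ℤP.pos-+ k 1)) (trans (cong +_ (trans (ℕP.+-comm k 1) (sym (ℕP.m∸n+n≡m j≤1+k)))) (ℤP.pos-+ m j))

invPow-sh : ∀ i a k j → j ℕ.≤ suc k → invPow i a * ℕ→ℚ (suc i) ^ℚ (suc k ℕ.∸ j) ≡ invPow i (sh a k j)
invPow-sh i a k j j≤1+k = trans (sym (invPow-∸ i a (suc k ℕ.∸ j))) (cong (invPow i) (sym (sh≡∸ a k j j≤1+k)))

bernSum-cong : ∀ k {T T′ : ℕ → ℚ} → (∀ j → j ℕ.< suc (suc k) → T j ≡ T′ j) → bernSum k T ≡ bernSum k T′
bernSum-cong k T≡T′ = cong (((+ 1) ℚ./ suc k) *_)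
  (Σ<-cong-< (suc (suc k)) (λ j j≤1+k → cong (Cℚ (suc k) j * B j *_) (T≡T′ j j≤1+k)))

Σ<-bernSum : ∀ k n (w : ℕ → ℚ) (T : ℕ → ℕ → ℚ) →
  Σ< n (λ i → w i * bernSum k (T i)) ≡ bernSum k (λ j → Σ< n (λ i → w i * T i j))
Σ<-bernSum k n w T = begin
  Σ< n (λ i → w i * (c * Σ< K (λ j → A j * T i j)))
    ≡⟨ Σ<-cong n (λ i → trans (swap (w i) c _) (cong (c *_) (sym (Σ<-*ˡ K (w i) (λ j → A j * T i j))))) ⟩
  Σ< n (λ i → c * Σ< K (λ j → w i * (A j * T i j)))
    ≡⟨ Σ<-*ˡ n c _ ⟩
  c * Σ< n (λ i → Σ< K (λ j → w i * (A j * T i j)))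
    ≡⟨ cong (c *_) (Σ<-comm n K (λ i j → w i * (A j * T i j))) ⟩
  c * Σ< K (λ j → Σ< n (λ i → w i * (A j * T i j)))
    ≡⟨ cong (c *_) (Σ<-cong K (λ j → trans (Σ<-cong n (λ i → swap (w i) (A j) (T i j))) (Σ<-*ˡ n (A j) _))) ⟩
  c * Σ< K (λ j → A j * Σ< n (λ i → w i * T i j)) ∎
  where
  c = (+ 1) ℚ./ suc k
  K = suc (suc k)
  A : ℕ → ℚ
  A j = Cℚ (suc k) j * B j
  swap : ∀ a b c → a * (b * c) ≡ b * (a * c)
  swap = solve 3 (λ a b c → a :* (b :* c) := b :* (a :* c)) refl

-- Exchanging the two outermost summations: for fixed n₂ = x + 1 + t, n₁ = x + 1 + i runs over i < t.
zetaFrom-cons-reorder : ∀ (f : ℕ → ℚ) b l x M →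
  Σ< (M ℕ.∸ suc x) (λ i → f i * zetaFrom (b ∷ l) (suc (x ℕ.+ i)) M)
    ≡ Σ< (M ℕ.∸ suc x) (λ t → invPow (x ℕ.+ t) b * zetaFrom l (suc (x ℕ.+ t)) M * Σ< t f)
zetaFrom-cons-reorder f b l x M = begin
  Σ< D (λ i → f i * zetaFrom (b ∷ l) (suc (x ℕ.+ i)) M)
    ≡⟨ Σ<-cong D expand ⟩
  Σ< D (λ i → Σ< (D ℕ.∸ suc i) (λ j → f i * W (suc (i ℕ.+ j))))
    ≡⟨ Σ<-triangle-strict D (λ i t → f i * W t) ⟩
  Σ< D (λ t → Σ< t (λ i → f i * W t))
    ≡⟨ Σ<-cong D (λ t → trans (Σ<-*ʳ t (W t) f) (ℚP.*-comm _ (W t))) ⟩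
  Σ< D (λ t → W t * Σ< t f) ∎
  where
  D = M ℕ.∸ suc x
  W : ℕ → ℚ
  W t = invPow (x ℕ.+ t) b * zetaFrom l (suc (x ℕ.+ t)) M
  expand : ∀ i → f i * zetaFrom (b ∷ l) (suc (x ℕ.+ i)) M ≡ Σ< (D ℕ.∸ suc i) (λ j → f i * W (suc (i ℕ.+ j)))
  expand i = begin
    f i * Σ< (M ℕ.∸ suc (suc (x ℕ.+ i))) (λ j → W′ (suc (x ℕ.+ i) ℕ.+ j))
      ≡⟨ Σ<-*ˡ (M ℕ.∸ suc (suc (x ℕ.+ i))) (f i) (λ j → W′ (suc (x ℕ.+ i) ℕ.+ j)) ⟨
    Σ< (M ℕ.∸ suc (suc (x ℕ.+ i))) (λ j → f i * W′ (suc (x ℕ.+ i) ℕ.+ j))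
      ≡⟨ cong (λ m → Σ< m (λ j → f i * W′ (suc (x ℕ.+ i) ℕ.+ j))) length≡ ⟩
    Σ< (D ℕ.∸ suc i) (λ j → f i * W′ (suc (x ℕ.+ i) ℕ.+ j))
      ≡⟨ Σ<-cong (D ℕ.∸ suc i) (λ j → cong (λ m → f i * W′ m) (reindex j)) ⟩
    Σ< (D ℕ.∸ suc i) (λ j → f i * W (suc (i ℕ.+ j))) ∎
    where
    W′ : ℕ → ℚ
    W′ n = invPow n b * zetaFrom l (suc n) M
    length≡ : M ℕ.∸ suc (suc (x ℕ.+ i)) ≡ D ℕ.∸ suc i
    length≡ = trans (cong (λ m → M ℕ.∸ suc m) (sym (ℕP.+-suc x i))) (sym (ℕP.∸-+-assoc M (suc x) (suc i)))
    reindex : ∀ j → suc (x ℕ.+ i) ℕ.+ j ≡ x ℕ.+ suc (i ℕ.+ j)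
    reindex j = trans (cong suc (ℕP.+-assoc x i j)) (sym (ℕP.+-suc x (i ℕ.+ j)))

-- The inner sum over x < n₁ < n₂ of n₁ᵏ is a power sum; Faulhaber's formula splits it into
-- a power of n₂, absorbed into the next entry, and a power of the lower bound x.
zetaFrom-negHead : ∀ k b l x M → zetaFrom (- (+ k) ∷ b ∷ l) x M
  ≡ bernSum k (λ j → (-1ℚ ^ℚ j) * zetaFrom (sh b k j ∷ l) x M - ℕ→ℚ x ^ℚ (suc k ℕ.∸ j) * zetaFrom (b ∷ l) x M)
zetaFrom-negHead k b l x M = begin
  Σ< D (λ i → invPow (x ℕ.+ i) (- (+ k)) * zetaFrom (b ∷ l) (suc (x ℕ.+ i)) M)
    ≡⟨ Σ<-cong D (λ i → cong (_* zetaFrom (b ∷ l) (suc (x ℕ.+ i)) M) (invPow-neg (x ℕ.+ i) k)) ⟩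
  Σ< D (λ i → P i * zetaFrom (b ∷ l) (suc (x ℕ.+ i)) M)
    ≡⟨ zetaFrom-cons-reorder P b l x M ⟩
  Σ< D (λ t → W t * Σ< t P)
    ≡⟨ Σ<-cong D (λ t → cong (W t *_) (faulhaber k x t)) ⟩
  Σ< D (λ t → W t * bernSum k (λ j → U t j - V j))
    ≡⟨ Σ<-bernSum k D W (λ t j → U t j - V j) ⟩
  bernSum k (λ j → Σ< D (λ t → W t * (U t j - V j)))
    ≡⟨ bernSum-cong k (λ j j≤1+k → trans (Σ<-cong D (λ t → ℚP.*-distribˡ-+ (W t) (U t j) (ℚ.- V j)))
                                  (trans (Σ<-+ D _ _) (cong₂ _+_ (shiftedEntry j j≤1+k) (lowerBound j)))) ⟩
  bernSum k (λ j → (-1ℚ ^ℚ j) * zetaFrom (sh b k j ∷ l) x M - ℕ→ℚ x ^ℚ (suc k ℕ.∸ j) * zetaFrom (b ∷ l) x M) ∎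
  where
  D = M ℕ.∸ suc x
  P : ℕ → ℚ
  P i = ℕ→ℚ (suc (x ℕ.+ i)) ^ℚ k
  W : ℕ → ℚ
  W t = invPow (x ℕ.+ t) b * zetaFrom l (suc (x ℕ.+ t)) M
  U : ℕ → ℕ → ℚ
  U t j = (-1ℚ ^ℚ j) * ℕ→ℚ (suc (x ℕ.+ t)) ^ℚ (suc k ℕ.∸ j)
  V : ℕ → ℚ
  V j = ℕ→ℚ x ^ℚ (suc k ℕ.∸ j)
  shiftedEntry : ∀ j → j ℕ.< suc (suc k) → Σ< D (λ t → W t * U t j) ≡ (-1ℚ ^ℚ j) * zetaFrom (sh b k j ∷ l) x M
  shiftedEntry j (s≤s j≤1+k) = trans (Σ<-cong D regroup) (Σ<-*ˡ D (-1ℚ ^ℚ j) _)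
    where
    regroup : ∀ t → W t * U t j ≡ (-1ℚ ^ℚ j) * (invPow (x ℕ.+ t) (sh b k j) * zetaFrom l (suc (x ℕ.+ t)) M)
    regroup t = trans
      (solve 4 (λ a z s y → (a :* z) :* (s :* y) := s :* ((a :* y) :* z)) refl
        (invPow (x ℕ.+ t) b) (zetaFrom l (suc (x ℕ.+ t)) M) (-1ℚ ^ℚ j) (ℕ→ℚ (suc (x ℕ.+ t)) ^ℚ (suc k ℕ.∸ j)))
      (cong (λ z → (-1ℚ ^ℚ j) * (z * zetaFrom l (suc (x ℕ.+ t)) M)) (invPow-sh (x ℕ.+ t) b k j j≤1+k))
  lowerBound : ∀ j → Σ< D (λ t → W t * ℚ.- V j) ≡ ℚ.- (V j * zetaFrom (b ∷ l) x M)
  lowerBound j = trans (Σ<-*ʳ D (ℚ.- V j) W) (trans (ℚP.*-comm _ (ℚ.- V j)) (sym (ℚP.neg-distribˡ-* (V j) _)))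

zetaFrom-negSingleton : ∀ k x M → x ℕ.< M → zetaFrom (- (+ k) ∷ []) x M
  ≡ bernSum k (λ j → (-1ℚ ^ℚ j) * ℕ→ℚ M ^ℚ (suc k ℕ.∸ j) - ℕ→ℚ x ^ℚ (suc k ℕ.∸ j))
zetaFrom-negSingleton k x M x<M = begin
  Σ< (M ℕ.∸ suc x) (λ i → invPow (x ℕ.+ i) (- (+ k)) * 1ℚ)
    ≡⟨ Σ<-cong (M ℕ.∸ suc x) (λ i → trans (ℚP.*-identityʳ _) (invPow-neg (x ℕ.+ i) k)) ⟩
  Σ< (M ℕ.∸ suc x) (λ i → ℕ→ℚ (suc (x ℕ.+ i)) ^ℚ k)
    ≡⟨ faulhaber k x (M ℕ.∸ suc x) ⟩
  bernSum k (λ j → (-1ℚ ^ℚ j) * ℕ→ℚ (suc (x ℕ.+ (M ℕ.∸ suc x))) ^ℚ (suc k ℕ.∸ j) - ℕ→ℚ x ^ℚ (suc k ℕ.∸ j))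
    ≡⟨ cong (λ m → bernSum k (λ j → (-1ℚ ^ℚ j) * ℕ→ℚ m ^ℚ (suc k ℕ.∸ j) - ℕ→ℚ x ^ℚ (suc k ℕ.∸ j)))
            (ℕP.m+[n∸m]≡n x<M) ⟩
  bernSum k (λ j → (-1ℚ ^ℚ j) * ℕ→ℚ M ^ℚ (suc k ℕ.∸ j) - ℕ→ℚ x ^ℚ (suc k ℕ.∸ j)) ∎

1+x+i<M : ∀ x M i → i ℕ.< M ℕ.∸ suc x → suc (x ℕ.+ i) ℕ.< M
1+x+i<M x M i i<D = subst (suc (x ℕ.+ i) ℕ.<_) (ℕP.m+[n∸m]≡n 1+x≤M) (ℕP.+-monoʳ-< (suc x) i<D)
  where
  1+x≤M : suc x ℕ.≤ M
  1+x≤M = ℕP.<⇒≤ (ℕP.m∸n≢0⇒n<m (λ D≡0 → ℕP.n≮0 (subst (i ℕ.<_) D≡0 i<D)))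

-- The powers of the lower bound left by Faulhaber's formula shift the preceding entry a.
zetaFrom-absorb : ∀ k a l (u : ℕ → ℚ) (l′ : ℕ → List ℤ) l″ L M →
  (∀ y → y ℕ.< M → zetaFrom l y M
     ≡ bernSum k (λ j → u j * zetaFrom (l′ j) y M - ℕ→ℚ y ^ℚ (suc k ℕ.∸ j) * zetaFrom l″ y M)) →
  zetaFrom (a ∷ l) L M ≡ bernSum k (λ j → u j * zetaFrom (a ∷ l′ j) L M - zetaFrom (sh a k j ∷ l″) L M)
zetaFrom-absorb k a l u l′ l″ L M inner = begin
  Σ< D (λ i → w i * zetaFrom l (y i) M)
    ≡⟨ Σ<-cong-< D (λ i i<D → cong (w i *_) (inner (y i) (1+x+i<M L M i i<D))) ⟩
  Σ< D (λ i → w i * bernSum k (λ j → u j * zetaFrom (l′ j) (y i) M - ℕ→ℚ (y i) ^ℚ (suc k ℕ.∸ j) * zetaFrom l″ (y i) M))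
    ≡⟨ Σ<-bernSum k D w _ ⟩
  bernSum k (λ j → Σ< D (λ i → w i * (u j * zetaFrom (l′ j) (y i) M - ℕ→ℚ (y i) ^ℚ (suc k ℕ.∸ j) * zetaFrom l″ (y i) M)))
    ≡⟨ bernSum-cong k (λ j j≤1+k → trans (Σ<-cong D (split j j≤1+k))
                                         (trans (Σ<-- D _ _) (cong (_- _) (Σ<-*ˡ D (u j) _)))) ⟩
  bernSum k (λ j → u j * zetaFrom (a ∷ l′ j) L M - zetaFrom (sh a k j ∷ l″) L M) ∎
  where
  D = M ℕ.∸ suc L
  y : ℕ → ℕ
  y i = suc (L ℕ.+ i)
  w : ℕ → ℚ
  w i = invPow (L ℕ.+ i) a
  split : ∀ j → j ℕ.< suc (suc k) → ∀ i →
    w i * (u j * zetaFrom (l′ j) (y i) M - ℕ→ℚ (y i) ^ℚ (suc k ℕ.∸ j) * zetaFrom l″ (y i) M)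
      ≡ u j * (w i * zetaFrom (l′ j) (y i) M) - invPow (L ℕ.+ i) (sh a k j) * zetaFrom l″ (y i) M
  split j (s≤s j≤1+k) i = begin
    w i * (u j * Z′ - Y * Z″)
      ≡⟨ solve 5 (λ w u a y b → w :* (u :* a :- y :* b) := u :* (w :* a) :- (w :* y) :* b) refl (w i) (u j) Z′ Y Z″ ⟩
    u j * (w i * Z′) - (w i * Y) * Z″
      ≡⟨ cong (λ z → u j * (w i * Z′) - z * Z″) (invPow-sh (L ℕ.+ i) a k j j≤1+k) ⟩
    u j * (w i * Z′) - invPow (L ℕ.+ i) (sh a k j) * Z″ ∎
    where
    Z′ = zetaFrom (l′ j) (y i) M
    Z″ = zetaFrom l″ (y i) M
    Y = ℕ→ℚ (y i) ^ℚ (suc k ℕ.∸ j)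

zetaFrom-++ : ∀ k pre l (u : ℕ → ℚ) (X Y : ℕ → List ℤ) M →
  (∀ L → zetaFrom l L M ≡ bernSum k (λ j → u j * zetaFrom (X j) L M - zetaFrom (Y j) L M)) →
  ∀ L → zetaFrom (pre ++ l) L M ≡ bernSum k (λ j → u j * zetaFrom (pre ++ X j) L M - zetaFrom (pre ++ Y j) L M)
zetaFrom-++ k [] l u X Y M base L = base L
zetaFrom-++ k (e ∷ pre) l u X Y M base L = begin
  Σ< D (λ i → w i * zetaFrom (pre ++ l) (suc (L ℕ.+ i)) M)
    ≡⟨ Σ<-cong D (λ i → cong (w i *_) (zetaFrom-++ k pre l u X Y M base (suc (L ℕ.+ i)))) ⟩
  Σ< D (λ i → w i * bernSum k (λ j → u j * Z (X j) i - Z (Y j) i))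
    ≡⟨ Σ<-bernSum k D w _ ⟩
  bernSum k (λ j → Σ< D (λ i → w i * (u j * Z (X j) i - Z (Y j) i)))
    ≡⟨ bernSum-cong k (λ j _ → trans (Σ<-cong D (λ i → split (u j) (Z (X j) i) (Z (Y j) i) (w i)))
                                     (trans (Σ<-- D _ _) (cong (_- _) (Σ<-*ˡ D (u j) _)))) ⟩
  bernSum k (λ j → u j * zetaFrom (e ∷ pre ++ X j) L M - zetaFrom (e ∷ pre ++ Y j) L M) ∎
  where
  D = M ℕ.∸ suc L
  w : ℕ → ℚ
  w i = invPow (L ℕ.+ i) e
  Z : List ℤ → ℕ → ℚ
  Z q i = zetaFrom (pre ++ q) (suc (L ℕ.+ i)) M
  split : ∀ u a b w → w * (u * a - b) ≡ u * (w * a) - w * b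
  split = solve 4 (λ u a b w → w :* (u :* a :- b) := u :* (w :* a) :- w :* b) refl

0^[1+k∸j]≡δ : ∀ k j → j ℕ.< suc (suc k) → ℕ→ℚ 0 ^ℚ (suc k ℕ.∸ j) ≡ δ j (suc k)
0^[1+k∸j]≡δ k j (s≤s j≤1+k) with ℕP.m≤n⇒m<n∨m≡n j≤1+k
... | inj₂ refl rewrite Equivalence.to T-≡ (ℕP.≤⇒≤ᵇ (ℕP.≤-refl {suc k})) | ℕP.n∸n≡0 k = refl
... | inj₁ (s≤s j≤k) rewrite Equivalence.to T-≡ (ℕP.≤⇒≤ᵇ j≤1+k) | ℕP.+-∸-assoc 1 j≤k
                           | m≤n⇒n<ᵇm≡false j≤k = ℚP.*-zeroˡ (ℕ→ℚ 0 ^ℚ (k ℕ.∸ j))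

≈Â-reflexive : ∀ {x y : ℕ → ℚ} → x ≗ y → x ≈Â y
≈Â-reflexive {x} {y} x≗y n = 0 , λ p _ _ →
  subst (λ q → (p ℕ.^ n) ∣ ℤ.∣ ℚ.↥ q ∣) (sym (trans (cong (_- y p) (x≗y p)) (ℚP.+-inverseʳ (y p)))) ((p ℕ.^ n) ∣0)

zetaFrom-negMiddle : ∀ k pre a b post L M → zetaFrom (pre ++ a ∷ - (+ k) ∷ b ∷ post) L M
  ≡ bernSum k (λ j → (-1ℚ ^ℚ j) * zetaFrom (pre ++ a ∷ sh b k j ∷ post) L M - zetaFrom (pre ++ sh a k j ∷ b ∷ post) L M)
zetaFrom-negMiddle k pre a b post L M =
  zetaFrom-++ k pre (a ∷ - (+ k) ∷ b ∷ post) (-1ℚ ^ℚ_) (λ j → a ∷ sh b k j ∷ post) (λ j → sh a k j ∷ b ∷ post) M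
    (λ L′ → zetaFrom-absorb k a (- (+ k) ∷ b ∷ post) (-1ℚ ^ℚ_) (λ j → sh b k j ∷ post) (b ∷ post) L′ M
              (λ y _ → zetaFrom-negHead k b post y M)) L

zetaFrom-negLast : ∀ k pre a L M → zetaFrom (pre ++ a ∷ - (+ k) ∷ []) L M
  ≡ bernSum k (λ j → (-1ℚ ^ℚ j) * zetaFrom (pre ++ a ∷ []) L M * ℕ→ℚ M ^ℚ (suc k ℕ.∸ j) - zetaFrom (pre ++ sh a k j ∷ []) L M)
zetaFrom-negLast k pre a L M = trans
  (zetaFrom-++ k pre (a ∷ - (+ k) ∷ []) u (λ _ → a ∷ []) (λ j → sh a k j ∷ []) M
    (λ L′ → zetaFrom-absorb k a (- (+ k) ∷ []) u (λ _ → []) [] L′ M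
              (λ y y<M → trans (zetaFrom-negSingleton k y M y<M) (bernSum-cong k (λ j _ → times1 (u j) _)))) L)
  (bernSum-cong k (λ j _ → cong (_- zetaFrom (pre ++ sh a k j ∷ []) L M)
    (solve 3 (λ s q z → (s :* q) :* z := s :* z :* q) refl
       (-1ℚ ^ℚ j) (ℕ→ℚ M ^ℚ (suc k ℕ.∸ j)) (zetaFrom (pre ++ a ∷ []) L M))))
  where
  u : ℕ → ℚ
  u j = (-1ℚ ^ℚ j) * ℕ→ℚ M ^ℚ (suc k ℕ.∸ j)
  times1 : ∀ a b → a - b ≡ a * 1ℚ - b * 1ℚ
  times1 = solve 2 (λ a b → a :- b := a :* con 1ℚ :- b :* con 1ℚ) refl

theorem1p3 :
  -- (i) m = 1 : k = (-k, k₂, k₃, …, k_r)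
  (∀ (k : ℕ) (k₂ : ℤ) (rest : List ℤ) →
    ζÂ ((- (+ k)) ∷ k₂ ∷ rest) ≈Â
      (λ p → bernSum k (λ j →
        ((-1ℚ ^ℚ j) * ζÂ (sh k₂ k j ∷ rest) p) - (δ j (ℕ.suc k) * ζÂ (k₂ ∷ rest) p))))
  ×
  -- (ii) 1 < m < r : k = (pre, k_{m-1}, -k, k_{m+1}, post)
  (∀ (k : ℕ) (pre : List ℤ) (a b : ℤ) (post : List ℤ) →
    ζÂ (pre ++ a ∷ (- (+ k)) ∷ b ∷ post) ≈Â
      (λ p → bernSum k (λ j →
        ((-1ℚ ^ℚ j) * ζÂ (pre ++ a ∷ sh b k j ∷ post) p) - ζÂ (pre ++ sh a k j ∷ b ∷ post) p)))
  ×
  -- (iii) m = r : k = (pre, k_{r-1}, -k)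
  (∀ (k : ℕ) (pre : List ℤ) (a : ℤ) →
    ζÂ (pre ++ a ∷ (- (+ k)) ∷ []) ≈Â
      (λ p → bernSum k (λ j →
        ((-1ℚ ^ℚ j) * ζÂ (pre ++ a ∷ []) p * (𝒑 p ^ℚ (ℕ.suc k ℕ.∸ j))) - ζÂ (pre ++ sh a k j ∷ []) p)))
theorem1p3 =
  (λ k k₂ rest → ≈Â-reflexive λ p → trans (zetaFrom-negHead k k₂ rest 0 p)
     (bernSum-cong k (λ j j≤1+k → cong (λ z → (-1ℚ ^ℚ j) * ζÂ (sh k₂ k j ∷ rest) p - z * ζÂ (k₂ ∷ rest) p)
                                       (0^[1+k∸j]≡δ k j j≤1+k)))) ,
  (λ k pre a b post → ≈Â-reflexive λ p → zetaFrom-negMiddle k pre a b post 0 p) ,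
  (λ k pre a → ≈Â-reflexive λ p → zetaFrom-negLast k pre a 0 p)
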